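{- Let $G$ be a finite group, $X$ a finite $G$-set, $r\ge1$ an integer, $A$ a finite set with $|A|\ge2$, $a\in A$, $N_c=\{0,1\}$, $P=A^r$ ($r$-fold cartesian product) and $p=(a,\dots,a)\in P$. Suppose there exist a finite group $G'$ containing $G$ as a subgroup and a finite $G'$-set $Y$ such that $[\mathrm{Res}^{G'}_G(Y)]=r[X]$ in the Burnside ring $B(G)$ (i.e. $\mathrm{Res}^{G'}_G(Y)$ is $G$-isomorphic to a disjoint union of $r$ copies of $X$). Then the $G$-set $J_{N_c,P,p}(X)$ is $G$-isomorphic to $\mathrm{Res}^{G'}_G(J_{N_c,A,a}(Y))$. In particular, for every $H\in\Phi(G)$, \[\mu_H(J_{N_c,P,p}(X))=\sum_{V\in\Phi(G')}c_V(H)\,\mu_V(J_{N_c,A,a}(Y)),\] where $c_V(H)=\mu_H(\mathrm{Res}^{G'}_G(G'/V))$.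
   Context: For a finite group $K$, a finite $K$-set $Z$, a finite set $C$ with $|C|\ge2$ and $c\in C$: let $C'=C\setminus\{c\}$, $C'^{[1]}$ the maps $\{1\}\to C'$, $C'^{[0]}=\{c\}$; $J_{N_c,C,c}(Z)$ is the set of maps $f:Z\to C'^{[0]}\sqcup C'^{[1]}$ with $K$-action $(kf)(z)=f(k^{ -1}z)$. $\mathrm{Res}^{G'}_G$ means regarding a $G'$-set as a $G$-set. $\Phi(G)$, $\Phi(G')$ are the sets of conjugacy classes of subgroups. For a finite $G$-set $Z$, $\mu_H(Z)$ is the number of $G$-orbits isomorphic to $G/H$; for a finite $G'$-set $W$, $\mu_V(W)$ is the number of $G'$-orbits isomorphic to $G'/V$. $B(G)$ is the Grothendieck ring of finite $G$-sets under disjoint union and product. -}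

module Defs where

open import Data.Nat using (ℕ)
open import Data.Fin using (Fin)
open import Data.Fin.Subset using (Subset; _∈_)
open import Data.Vec using (Vec; tabulate; lookup)
open import Data.Product using (Σ; Σ-syntax; _×_; _,_)
open import Data.Sum using (_⊎_)
open import Relation.Binary.PropositionalEquality using (_≡_)
open import Relation.Binary.Definitions using (DecidableEquality)
open import Relation.Nullary.Decidable using (True; False)

-- Finite groups (carrier Fin order; every finite group is isomorphic
-- to one of this form)

record FinGroup : Set where
  infixl 7 _·_
  field
    order     : ℕ
    _·_       : Fin order → Fin order → Fin order
    e         : Fin order
    inv       : Fin order → Fin order
    assoc     : ∀ x y z → (x · y) · z ≡ x · (y · z)
    identityˡ : ∀ x → e · x ≡ x
    identityʳ : ∀ x → x · e ≡ x
    inverseˡ  : ∀ x → inv x · x ≡ e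
    inverseʳ  : ∀ x → x · inv x ≡ e

El : FinGroup → Set
El G = Fin (FinGroup.order G)

record SubgroupEmbedding (G G' : FinGroup) : Set where
  open FinGroup G  renaming (_·_ to _·₁_)
  open FinGroup G' renaming (_·_ to _·₂_)
  field
    map       : El G → El G'
    hom       : ∀ x y → map (x ·₁ y) ≡ map x ·₂ map y
    injective : ∀ x y → map x ≡ map y → x ≡ y

record Subgroup (G : FinGroup) : Set where
  open FinGroup G
  field
    members    : Subset order
    has-e      : e ∈ members
    closed-·   : ∀ {x y} → x ∈ members → y ∈ members → (x · y) ∈ members
    closed-inv : ∀ {x} → x ∈ members → inv x ∈ members

Conjugate : (G : FinGroup) → Subgroup G → Subgroup G → Set
Conjugate G H K =
  Σ[ g ∈ El G ] (∀ h → (h ∈ Subgroup.members H → ((g · h) · inv g) ∈ Subgroup.members K)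
                     × (((g · h) · inv g) ∈ Subgroup.members K → h ∈ Subgroup.members H))
  where open FinGroup G

ConjugacyReps : (G : FinGroup) {t : ℕ} → (Fin t → Subgroup G) → Set
ConjugacyReps G {t} V =
  (∀ (W : Subgroup G) → Σ[ i ∈ Fin t ] Conjugate G W (V i))
  × (∀ i j → Conjugate G (V i) (V j) → i ≡ j)

record FinGSet (G : FinGroup) : Set where
  open FinGroup G
  field
    size  : ℕ
    act   : El G → Fin size → Fin size
    act-e : ∀ x → act e x ≡ x
    act-· : ∀ g h x → act (g · h) x ≡ act g (act h x)

-- G-actions on setoids (carrier with an equivalence relation _≈_).
-- All constructions below produce genuine G-sets; laws are not recorded.
record Action (G : FinGroup) : Set₁ where
  field
    Carrier : Set
    _≈_     : Carrier → Carrier → Set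
    act     : El G → Carrier → Carrier

toAction : {G : FinGroup} → FinGSet G → Action G
toAction X = record { Carrier = Fin (FinGSet.size X) ; _≈_ = _≡_ ; act = FinGSet.act X }

record _≅_ {G : FinGroup} (A B : Action G) : Set where
  open Action A renaming (Carrier to CA; _≈_ to _≈A_; act to actA)
  open Action B renaming (Carrier to CB; _≈_ to _≈B_; act to actB)
  field
    to          : CA → CB
    from        : CB → CA
    to-cong     : ∀ {x y} → x ≈A y → to x ≈B to y
    from-cong   : ∀ {x y} → x ≈B y → from x ≈A from y
    from-to     : ∀ x → from (to x) ≈A x
    to-from     : ∀ y → to (from y) ≈B y
    equivariant : ∀ g x → to (actA g x) ≈B actB g (to x)

Res : {G G' : FinGroup} → SubgroupEmbedding G G' → Action G' → Action G
Res ι A = record { Carrier = Carrier ; _≈_ = _≈_ ; act = λ g x → act (SubgroupEmbedding.map ι g) x }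
  where open Action A

copies : {G : FinGroup} → ℕ → FinGSet G → Action G
copies r X = record
  { Carrier = Fin r × Fin (FinGSet.size X)
  ; _≈_ = _≡_
  ; act = λ { g (i , x) → (i , FinGSet.act X g x) } }

Coset : {G : FinGroup} → Subgroup G → Action G
Coset {G} H = record
  { Carrier = El G
  ; _≈_ = λ x y → (inv x · y) ∈ Subgroup.members H
  ; act = _·_ }
  where open FinGroup G

-- the orbit G·x as a G-set, presented as G modulo g ~ g' iff g x ≈ g' x
Orbit : {G : FinGroup} (A : Action G) → Action.Carrier A → Action G
Orbit {G} A x = record
  { Carrier = El G
  ; _≈_ = λ g g' → act g x ≈ act g' x
  ; act = _·_ }
  where open FinGroup G
        open Action A

SameOrbit : {G : FinGroup} (A : Action G) → Action.Carrier A → Action.Carrier A → Set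
SameOrbit {G} A x y = Σ[ g ∈ El G ] (act g x ≈ y)
  where open Action A

-- HasMu A H n : μ_H(A) = n, i.e. A has exactly n G-orbits isomorphic to G/H
HasMu : {G : FinGroup} (A : Action G) → Subgroup G → ℕ → Set
HasMu A H n =
  Σ[ xs ∈ (Fin n → Action.Carrier A) ]
    ((∀ i → Orbit A (xs i) ≅ Coset H)
    × (∀ i j → SameOrbit A (xs i) (xs j) → i ≡ j)
    × (∀ y → Orbit A y ≅ Coset H → Σ[ i ∈ Fin n ] SameOrbit A (xs i) y))

C⁰ : (C : Set) → DecidableEquality C → C → Set
C⁰ C _≟_ c = Σ[ x ∈ C ] True (x ≟ c)

C' : (C : Set) → DecidableEquality C → C → Set
C' C _≟_ c = Σ[ x ∈ C ] False (x ≟ c)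

-- C'^{[1]} = maps {1} → C', i.e. 1-tuples in C'
C¹ : (C : Set) → DecidableEquality C → C → Set
C¹ C _≟_ c = Vec (C' C _≟_ c) 1

-- maps f : Z → C'^{[0]} ⊔ C'^{[1]} (Z = Fin size, maps as tuples),
-- with (k f)(z) = f(k⁻¹ z)
J : (C : Set) → DecidableEquality C → C → {K : FinGroup} → FinGSet K → Action K
J C _≟_ c {K} Z = record
  { Carrier = Vec (C⁰ C _≟_ c ⊎ C¹ C _≟_ c) (FinGSet.size Z)
  ; _≈_ = _≡_
  ; act = λ k f → tabulate (λ z → lookup f (FinGSet.act Z (FinGroup.inv K k) z)) }

-- J_{N_c,C,c}(Z) is the set of maps Z → C'^{[0]} ⊔ C'^{[1]}, and
-- C'^{[0]} ⊔ C'^{[1]} is in bijection with C.  So the two sides are the maps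
-- X → A^r and Y → A, which correspond by currying along Res Y ≅ r·X.
--
-- By orbit–stabiliser, μ_H(Z) = n says that Z has n orbits whose
-- stabilisers are conjugate to H (a "census"); censuses are invariant under
-- isomorphism, so μ_H(J(X)) = μ_H(Res J(Y)).  A Mackey-type count then gives
-- μ_H(Res W) = Σ_V μ_H(Res G'/V) · μ_V(W) for every G'-set W with decidable
-- equality: each G'-orbit of W of type V is a copy of G'/V, and its G-orbits
-- of type H are those of Res G'/V.

module Submission where

open import Defs
open import Data.Nat using (ℕ; zero; suc; _≤_; _*_)
open import Data.Fin using (Fin; zero; suc; _≟_)
open import Data.Fin.Properties using (+↔⊎; *↔×; cantor-schröder-bernstein)
open import Data.Fin.Subset using (Subset; _∈_)
open import Data.Vec using (Vec; []; _∷_; replicate; tabulate; lookup; sum)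
open import Data.Vec.Properties
  using (≡-dec; lookup∘tabulate; tabulate∘lookup; tabulate-cong; []=⇒lookup; lookup⇒[]=)
open import Data.Product using (Σ; Σ-syntax; _×_; _,_; proj₁; proj₂)
open import Data.Product.Function.Dependent.Propositional using (congˡ)
open import Data.Sum using (_⊎_; inj₁; inj₂)
open import Data.Sum.Function.Propositional using (_⊎-↔_)
open import Data.Bool using (true)
open import Data.Bool.Properties using (T-irrelevant)
open import Data.Empty using (⊥-elim)
open import Function.Bundles using (Inverse; Injection; _↔_; mk↔ₛ′)
open import Function.Properties.Inverse using (↔-refl; ↔-sym; ↔-trans; ↔⇒↣)
open import Relation.Nullary using (Dec; yes; no; does)
open import Relation.Binary.Definitions using (DecidableEquality)
open import Relation.Nullary.Decidable
  using (True; False; dec-true; via-injection; fromWitness; fromWitnessFalse; toWitness; toWitnessFalse)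
open import Relation.Binary.PropositionalEquality
  using (_≡_; refl; sym; trans; cong; cong₂; subst; module ≡-Reasoning)

_⇔ᴾ_ : {X : Set} → (X → Set) → (X → Set) → Set
S ⇔ᴾ T = ∀ h → (S h → T h) × (T h → S h)

⇔ᴾ-sym : {X : Set} {S T : X → Set} → S ⇔ᴾ T → T ⇔ᴾ S
⇔ᴾ-sym eq h = proj₂ (eq h) , proj₁ (eq h)

⇔ᴾ-trans : {X : Set} {S T U : X → Set} → S ⇔ᴾ T → T ⇔ᴾ U → S ⇔ᴾ U
⇔ᴾ-trans eq eq' h = (λ s → proj₁ (eq' h) (proj₁ (eq h) s)) , (λ u → proj₂ (eq h) (proj₂ (eq' h) u))

module GroupLemmas (G : FinGroup) where
  open FinGroup G
  open ≡-Reasoning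

  inv-uniqueʳ : ∀ x y → x · y ≡ e → y ≡ inv x
  inv-uniqueʳ x y p = begin
    y               ≡⟨ sym (identityˡ y) ⟩
    e · y           ≡⟨ cong (_· y) (sym (inverseˡ x)) ⟩
    (inv x · x) · y ≡⟨ assoc _ _ _ ⟩
    inv x · (x · y) ≡⟨ cong (inv x ·_) p ⟩
    inv x · e       ≡⟨ identityʳ _ ⟩
    inv x           ∎

  inv-inv : ∀ g → inv (inv g) ≡ g
  inv-inv g = sym (inv-uniqueʳ (inv g) g (inverseˡ g))

  inv-e : inv e ≡ e
  inv-e = sym (inv-uniqueʳ e e (identityˡ e))

  inv-· : ∀ g h → inv (g · h) ≡ inv h · inv g
  inv-· g h = sym (inv-uniqueʳ (g · h) (inv h · inv g) (begin
    (g · h) · (inv h · inv g) ≡⟨ assoc _ _ _ ⟩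
    g · (h · (inv h · inv g)) ≡⟨ cong (g ·_) (sym (assoc _ _ _)) ⟩
    g · ((h · inv h) · inv g) ≡⟨ cong (λ u → g · (u · inv g)) (inverseʳ h) ⟩
    g · (e · inv g)           ≡⟨ cong (g ·_) (identityˡ _) ⟩
    g · inv g                 ≡⟨ inverseʳ g ⟩
    e                         ∎))

  idempotent⇒e : ∀ x → x · x ≡ x → x ≡ e
  idempotent⇒e x p = begin
    x               ≡⟨ sym (identityˡ x) ⟩
    e · x           ≡⟨ cong (_· x) (sym (inverseˡ x)) ⟩
    (inv x · x) · x ≡⟨ assoc _ _ _ ⟩
    inv x · (x · x) ≡⟨ cong (inv x ·_) p ⟩
    inv x · x       ≡⟨ inverseˡ x ⟩
    e               ∎

  cancel-inv-left : ∀ a b → a · (inv a · b) ≡ b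
  cancel-inv-left a b = trans (sym (assoc _ _ _)) (trans (cong (_· b) (inverseʳ a)) (identityˡ b))

  cancel-left : ∀ a b → inv a · (a · b) ≡ b
  cancel-left a b = trans (sym (assoc _ _ _)) (trans (cong (_· b) (inverseˡ a)) (identityˡ b))

  cancel-inv-right : ∀ a b → (a · inv b) · b ≡ a
  cancel-inv-right a b = trans (assoc _ _ _) (trans (cong (a ·_) (inverseˡ b)) (identityʳ a))

  cancel-right : ∀ a b → (a · b) · inv b ≡ a
  cancel-right a b = trans (assoc _ _ _) (trans (cong (a ·_) (inverseʳ b)) (identityʳ a))

  conj : El G → El G → El G
  conj g h = (g · h) · inv g

  conj-e : ∀ h → conj e h ≡ h
  conj-e h = trans (cong₂ _·_ (identityˡ h) inv-e) (identityʳ h)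

  conj-conj : ∀ g g' h → conj g (conj g' h) ≡ conj (g · g') h
  conj-conj g g' h = begin
    (g · ((g' · h) · inv g')) · inv g ≡⟨ assoc _ _ _ ⟩
    g · (((g' · h) · inv g') · inv g) ≡⟨ cong (g ·_) (assoc _ _ _) ⟩
    g · ((g' · h) · (inv g' · inv g)) ≡⟨ sym (assoc _ _ _) ⟩
    (g · (g' · h)) · (inv g' · inv g) ≡⟨ cong₂ _·_ (sym (assoc _ _ _)) (sym (inv-· g g')) ⟩
    ((g · g') · h) · inv (g · g')     ∎

  conj-translate : ∀ u a b → inv (a · u) · (b · u) ≡ conj (inv u) (inv a · b)
  conj-translate u a b = begin
    inv (a · u) · (b · u)                ≡⟨ cong (_· (b · u)) (inv-· a u) ⟩
    (inv u · inv a) · (b · u)            ≡⟨ sym (assoc _ _ _) ⟩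
    ((inv u · inv a) · b) · u            ≡⟨ cong (_· u) (assoc _ _ _) ⟩
    (inv u · (inv a · b)) · u            ≡⟨ cong ((inv u · (inv a · b)) ·_) (sym (inv-inv u)) ⟩
    (inv u · (inv a · b)) · inv (inv u)  ∎

  conj-inv : ∀ g h → conj g (conj (inv g) h) ≡ h
  conj-inv g h = trans (conj-conj g (inv g) h) (trans (cong (λ u → conj u h) (inverseʳ g)) (conj-e h))

  -- Two predicates on G are conjugate if g S g⁻¹ = T for some g.  For the
  -- membership predicates of subgroups this is literally Defs.Conjugate.
  Conjugateᴾ : (El G → Set) → (El G → Set) → Set
  Conjugateᴾ S T = Σ[ g ∈ El G ] (∀ h → (S h → T (conj g h)) × (T (conj g h) → S h))

  conjugate-sym : ∀ {S T} → Conjugateᴾ S T → Conjugateᴾ T S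
  conjugate-sym {S} {T} (g , f) = inv g , λ h →
    (λ th → proj₂ (f (conj (inv g) h)) (subst T (sym (conj-inv g h)) th)) ,
    (λ sh → subst T (conj-inv g h) (proj₁ (f (conj (inv g) h)) sh))

  conjugate-trans : ∀ {S T U} → Conjugateᴾ S T → Conjugateᴾ T U → Conjugateᴾ S U
  conjugate-trans {S} {T} {U} (g , f) (g' , f') = g' · g , λ h →
    (λ sh → subst U (conj-conj g' g h) (proj₁ (f' (conj g h)) (proj₁ (f h) sh))) ,
    (λ uh → proj₂ (f h) (proj₂ (f' (conj g h)) (subst U (sym (conj-conj g' g h)) uh)))

  conjugate-respˡ : ∀ {S S' T} → S ⇔ᴾ S' → Conjugateᴾ S T → Conjugateᴾ S' T
  conjugate-respˡ eq (g , f) = g , λ h →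
    (λ s' → proj₁ (f h) (proj₂ (eq h) s')) , (λ t → proj₁ (eq h) (proj₂ (f h) t))

  conjugate-respʳ : ∀ {S T T'} → T ⇔ᴾ T' → Conjugateᴾ S T → Conjugateᴾ S T'
  conjugate-respʳ eq (g , f) = g , λ h →
    (λ s → proj₁ (eq _) (proj₁ (f h) s)) , (λ t' → proj₂ (f h) (proj₂ (eq _) t'))

module SubgroupEmbeddingLemmas {G G' : FinGroup} (ι : SubgroupEmbedding G G') where
  open SubgroupEmbedding ι
  private
    module G = FinGroup G
    module G' = FinGroup G'
    module L' = GroupLemmas G'

  map-e : map G.e ≡ G'.e
  map-e = L'.idempotent⇒e (map G.e) (trans (sym (hom G.e G.e)) (cong map (G.identityˡ G.e)))

  map-inv : ∀ g → map (G.inv g) ≡ G'.inv (map g)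
  map-inv g = L'.inv-uniqueʳ (map g) (map (G.inv g))
    (trans (sym (hom g (G.inv g))) (trans (cong map (G.inverseʳ g)) map-e))

Stabiliser : {G : FinGroup} (A : Action G) → Action.Carrier A → El G → Set
Stabiliser A x g = Action._≈_ A (Action.act A g x) x

-- The action laws, stated up to the setoid equality of the action.  (Defs
-- records only the data of an action; the constructions we use are lawful.)
record Lawful {G : FinGroup} (A : Action G) : Set where
  open FinGroup G
  open Action A
  field
    refl≈    : ∀ {x} → x ≈ x
    sym≈     : ∀ {x y} → x ≈ y → y ≈ x
    trans≈   : ∀ {x y z} → x ≈ y → y ≈ z → x ≈ z
    act-cong : ∀ g {x y} → x ≈ y → act g x ≈ act g y
    act-e    : ∀ x → act e x ≈ x
    act-·    : ∀ g h x → act (g · h) x ≈ act g (act h x)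

module ActionLemmas {G : FinGroup} (A : Action G) (L : Lawful A) where
  open FinGroup G
  open Action A
  open Lawful L
  open GroupLemmas G

  ≡⇒≈ : ∀ {x y} → x ≡ y → x ≈ y
  ≡⇒≈ refl = refl≈

  Stab : Carrier → El G → Set
  Stab = Stabiliser A

  SO : Carrier → Carrier → Set
  SO = SameOrbit A

  act-inv-cancel : ∀ g x → act (inv g) (act g x) ≈ x
  act-inv-cancel g x =
    trans≈ (sym≈ (act-· _ _ _)) (trans≈ (≡⇒≈ (cong (λ u → act u x) (inverseˡ g))) (act-e x))

  act-inj : ∀ g {x y} → act g x ≈ act g y → x ≈ y
  act-inj g {x} {y} p =
    trans≈ (sym≈ (act-inv-cancel g x)) (trans≈ (act-cong (inv g) p) (act-inv-cancel g y))

  so-sym : ∀ {x y} → SO x y → SO y x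
  so-sym {x} (g , p) = inv g , trans≈ (act-cong (inv g) (sym≈ p)) (act-inv-cancel g x)

  so-trans : ∀ {x y z} → SO x y → SO y z → SO x z
  so-trans {x} (g , p) (h , q) = h · g , trans≈ (act-· h g x) (trans≈ (act-cong h p) q)

  so-≈ : ∀ {x y z} → SO x y → y ≈ z → SO x z
  so-≈ (g , p) q = g , trans≈ p q

  same-image⇒stab : ∀ x a b → act a x ≈ act b x → Stab x (inv a · b)
  same-image⇒stab x a b p =
    trans≈ (act-· _ _ _) (trans≈ (act-cong (inv a) (sym≈ p)) (act-inv-cancel a x))

  stab⇒same-image : ∀ x a b → Stab x (inv a · b) → act a x ≈ act b x
  stab⇒same-image x a b p = sym≈ (trans≈ (≡⇒≈ (cong (λ u → act u x) (sym (cancel-inv-left a b))))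
    (trans≈ (act-· _ _ _) (act-cong a p)))

  stab-≈ : ∀ {x y} → x ≈ y → Stab x ⇔ᴾ Stab y
  stab-≈ {x} {y} p h = (λ s → trans≈ (act-cong h (sym≈ p)) (trans≈ s p)) ,
                       (λ s → trans≈ (act-cong h p) (trans≈ s (sym≈ p)))

  stab-translate : ∀ u x → Conjugateᴾ (Stab x) (Stab (act u x))
  stab-translate u x = u , λ h → (λ s → trans≈ (key h) (act-cong u s)) ,
                                 (λ s → act-inj u (trans≈ (sym≈ (key h)) s))
    where
    key : ∀ h → act (conj u h) (act u x) ≈ act u (act h x)
    key h = trans≈ (act-· _ _ _) (trans≈ (act-cong _ (act-inv-cancel u x)) (act-· _ _ _))

  so⇒conjugate : ∀ {x y} → SO x y → Conjugateᴾ (Stab x) (Stab y)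
  so⇒conjugate {x} (u , p) = conjugate-respʳ (stab-≈ p) (stab-translate u x)

cosetLawful : {G : FinGroup} (H : Subgroup G) → Lawful (Coset H)
cosetLawful {G} H = record
  { refl≈    = λ {a} → ≡⇒≈ (refl {x = a})
  ; sym≈     = λ {a} {b} p →
      subst (_∈ members) (trans (inv-· (inv a) b) (cong (inv b ·_) (inv-inv a))) (closed-inv p)
  ; trans≈   = λ {a} {b} {c} p q →
      subst (_∈ members) (trans (assoc _ _ _) (cong (inv a ·_) (cancel-inv-left b c))) (closed-· p q)
  ; act-cong = λ g {x} {y} p → subst (_∈ members) (sym (translate g x y)) p
  ; act-e    = λ x → ≡⇒≈ (identityˡ x)
  ; act-·    = λ g h x → ≡⇒≈ (assoc g h x) }
  where
  open FinGroup G
  open Subgroup H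
  open GroupLemmas G
  ≡⇒≈ : ∀ {a b} → a ≡ b → (inv a · b) ∈ members
  ≡⇒≈ {a} refl = subst (_∈ members) (sym (inverseˡ a)) has-e
  translate : ∀ g x y → inv (g · x) · (g · y) ≡ inv x · y
  translate g x y =
    trans (cong (_· (g · y)) (inv-· g x)) (trans (assoc _ _ _) (cong (inv x ·_) (cancel-left g y)))

resLawful : {G G' : FinGroup} (ι : SubgroupEmbedding G G') (A : Action G') →
            Lawful A → Lawful (Res ι A)
resLawful ι A L = record
  { refl≈ = refl≈ ; sym≈ = sym≈ ; trans≈ = trans≈
  ; act-cong = λ g → act-cong (map g)
  ; act-e    = λ x → subst (λ u → act u x ≈ x) (sym map-e) (act-e x)
  ; act-·    = λ g h x → subst (λ u → act u x ≈ act (map g) (act (map h) x)) (sym (hom g h)) (act-· _ _ x) }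
  where
  open Lawful L
  open Action A
  open SubgroupEmbedding ι
  open SubgroupEmbeddingLemmas ι

≅-trans : {G : FinGroup} {A B C : Action G} → Lawful A → Lawful C → A ≅ B → B ≅ C → A ≅ C
≅-trans LA LC φ ψ = record
  { to          = λ x → ψ.to (φ.to x)
  ; from        = λ z → φ.from (ψ.from z)
  ; to-cong     = λ p → ψ.to-cong (φ.to-cong p)
  ; from-cong   = λ p → φ.from-cong (ψ.from-cong p)
  ; from-to     = λ x → A.trans≈ (φ.from-cong (ψ.from-to (φ.to x))) (φ.from-to x)
  ; to-from     = λ z → C.trans≈ (ψ.to-cong (φ.to-from (ψ.from z))) (ψ.to-from z)
  ; equivariant = λ g x → C.trans≈ (ψ.to-cong (φ.equivariant g x)) (ψ.equivariant g (φ.to x)) }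
  where
  module φ = _≅_ φ
  module ψ = _≅_ ψ
  module A = Lawful LA
  module C = Lawful LC

Res-≅ : {G G' : FinGroup} (ι : SubgroupEmbedding G G') {A B : Action G'} → A ≅ B → Res ι A ≅ Res ι B
Res-≅ ι φ = record
  { to = to ; from = from ; to-cong = to-cong ; from-cong = from-cong
  ; from-to = from-to ; to-from = to-from
  ; equivariant = λ g → equivariant (SubgroupEmbedding.map ι g) }
  where open _≅_ φ

vec-ext : {C : Set} {n : ℕ} (u v : Vec C n) → (∀ i → lookup u i ≡ lookup v i) → u ≡ v
vec-ext u v p = trans (sym (tabulate∘lookup u)) (trans (tabulate-cong p) (tabulate∘lookup v))

-- The K-set of all maps Z → C, with (k f)(z) = f(k⁻¹ z).  By definition,
-- J_{N_c,C,c}(Z) is the K-set of maps from Z into C'^{[0]} ⊔ C'^{[1]}.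
Maps : (C : Set) {K : FinGroup} → FinGSet K → Action K
Maps C {K} Z = record
  { Carrier = Vec C (FinGSet.size Z)
  ; _≈_     = _≡_
  ; act     = λ k f → tabulate (λ z → lookup f (FinGSet.act Z (FinGroup.inv K k) z)) }

module MapsLemmas {K : FinGroup} (Z : FinGSet K) where
  open FinGroup K
  open FinGSet Z
  open ≡-Reasoning

  _•_ : {C : Set} → El K → Vec C size → Vec C size
  _•_ {C} = Action.act (Maps C Z)

  lookup-• : {C : Set} → ∀ k (f : Vec C size) z → lookup (k • f) z ≡ lookup f (act (inv k) z)
  lookup-• k f z = lookup∘tabulate _ z

  mapsLawful : (C : Set) → Lawful (Maps C Z)
  mapsLawful C = record
    { refl≈ = refl ; sym≈ = sym ; trans≈ = trans ; act-cong = λ g → cong (g •_)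
    ; act-e = λ f → vec-ext _ f (λ z → begin
        lookup (e • f) z          ≡⟨ lookup-• e f z ⟩
        lookup f (act (inv e) z)  ≡⟨ cong (λ u → lookup f (act u z)) inv-e ⟩
        lookup f (act e z)        ≡⟨ cong (lookup f) (act-e z) ⟩
        lookup f z                ∎)
    ; act-· = λ g h f → vec-ext _ _ (λ z → begin
        lookup ((g · h) • f) z                    ≡⟨ lookup-• (g · h) f z ⟩
        lookup f (act (inv (g · h)) z)            ≡⟨ cong (λ u → lookup f (act u z)) (inv-· g h) ⟩
        lookup f (act (inv h · inv g) z)          ≡⟨ cong (lookup f) (act-· _ _ z) ⟩
        lookup f (act (inv h) (act (inv g) z))    ≡⟨ sym (lookup-• h f _) ⟩
        lookup (h • f) (act (inv g) z)            ≡⟨ sym (lookup-• g (h • f) z) ⟩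
        lookup (g • (h • f)) z                    ∎) }
    where open GroupLemmas K

  push : {E C : Set} → (E → C) → Vec E size → Vec C size
  push u f = tabulate (λ z → u (lookup f z))

  lookup-push : {E C : Set} (u : E → C) (f : Vec E size) (z : Fin size) →
                lookup (push u f) z ≡ u (lookup f z)
  lookup-push u f z = lookup∘tabulate _ z

  postcompose : {E C : Set} → E ↔ C → Maps E Z ≅ Maps C Z
  postcompose u = record
    { to = push u.to ; from = push u.from ; to-cong = cong (push u.to) ; from-cong = cong (push u.from)
    ; from-to = λ f → vec-ext _ f (λ z →
        trans (lookup-push u.from (push u.to f) z)
          (trans (cong u.from (lookup-push u.to f z)) (u.strictlyInverseʳ _)))
    ; to-from = λ f → vec-ext _ f (λ z →
        trans (lookup-push u.to (push u.from f) z)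
          (trans (cong u.to (lookup-push u.from f z)) (u.strictlyInverseˡ _)))
    ; equivariant = λ k f → vec-ext _ _ (λ z → begin
        lookup (push u.to (k • f)) z          ≡⟨ lookup-push u.to (k • f) z ⟩
        u.to (lookup (k • f) z)               ≡⟨ cong u.to (lookup-• k f z) ⟩
        u.to (lookup f (act (inv k) z))       ≡⟨ sym (lookup-push u.to f _) ⟩
        lookup (push u.to f) (act (inv k) z)  ≡⟨ sym (lookup-• k (push u.to f) z) ⟩
        lookup (k • push u.to f) z            ∎) }
    where module u = Inverse u

module ValueCode (C : Set) (_≟ᶜ_ : DecidableEquality C) (c : C) where
  Value : Set
  Value = C⁰ C _≟ᶜ_ c ⊎ C¹ C _≟ᶜ_ c

  decode : Value → C
  decode (inj₁ (x , _))       = x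
  decode (inj₂ ((x , _) ∷ [])) = x

  -- encoding along an arbitrary decision of x ≡ c; the membership proofs
  -- always refer to the canonical decision x ≟ᶜ c
  encodeBy : (x : C) → Dec (x ≡ c) → Value
  encodeBy x (yes x≡c) = inj₁ (x , fromWitness x≡c)
  encodeBy x (no x≢c)  = inj₂ ((x , fromWitnessFalse x≢c) ∷ [])

  encode : C → Value
  encode x = encodeBy x (x ≟ᶜ c)

  decode-encode : ∀ x → decode (encode x) ≡ x
  decode-encode x with x ≟ᶜ c
  ... | yes _ = refl
  ... | no _  = refl

  encodeBy-c : ∀ x d (q : True (x ≟ᶜ c)) → encodeBy x d ≡ inj₁ (x , q)
  encodeBy-c x (yes _) q  = cong (λ q' → inj₁ (x , q')) (T-irrelevant _ q)
  encodeBy-c x (no x≢c) q = ⊥-elim (x≢c (toWitness q))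

  encodeBy-C' : ∀ x d (q : False (x ≟ᶜ c)) → encodeBy x d ≡ inj₂ ((x , q) ∷ [])
  encodeBy-C' x (yes x≡c) q = ⊥-elim (toWitnessFalse q x≡c)
  encodeBy-C' x (no _) q    = cong (λ q' → inj₂ ((x , q') ∷ [])) (T-irrelevant _ q)

  encode-decode : ∀ v → encode (decode v) ≡ v
  encode-decode (inj₁ (x , q))        = encodeBy-c x (x ≟ᶜ c) q
  encode-decode (inj₂ ((x , q) ∷ [])) = encodeBy-C' x (x ≟ᶜ c) q

  valueCode : Value ↔ C
  valueCode = mk↔ₛ′ decode encode decode-encode encode-decode

  _≟ⱽ_ : DecidableEquality Value
  _≟ⱽ_ = via-injection (↔⇒↣ valueCode) _≟ᶜ_

-- If Res(Y) ≅ r·X, a map X → C^r is the same as a map r·X → C, hence as a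
-- map Y → C; this identification is G-equivariant.
module Currying {G G' : FinGroup} (ι : SubgroupEmbedding G G') (X : FinGSet G) (r : ℕ)
  (Y : FinGSet G') (θ : Res ι (toAction Y) ≅ copies r X) (C : Set) where
  module θ = _≅_ θ
  open FinGroup G
  open SubgroupEmbedding ι
  open SubgroupEmbeddingLemmas ι
  open ≡-Reasoning
  module X = FinGSet X
  module Y = FinGSet Y
  open MapsLemmas X using () renaming (_•_ to _•ˣ_; lookup-• to lookup-•ˣ)
  open MapsLemmas Y using () renaming (_•_ to _•ʸ_; lookup-• to lookup-•ʸ)

  entry : Vec (Vec C r) X.size → Fin r × Fin X.size → C
  entry f (i , x) = lookup (lookup f x) i

  entry-ext : ∀ f f' → (∀ p → entry f p ≡ entry f' p) → f ≡ f'
  entry-ext f f' eq = vec-ext f f' (λ x → vec-ext _ _ (λ i → eq (i , x)))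

  uncurryᶿ : Vec (Vec C r) X.size → Vec C Y.size
  uncurryᶿ f = tabulate (λ y → entry f (θ.to y))

  curryᶿ : Vec C Y.size → Vec (Vec C r) X.size
  curryᶿ g = tabulate (λ x → tabulate (λ i → lookup g (θ.from (i , x))))

  entry-curry : ∀ g p → entry (curryᶿ g) p ≡ lookup g (θ.from p)
  entry-curry g (i , x) =
    trans (cong (λ v → lookup v i) (lookup∘tabulate _ x)) (lookup∘tabulate _ i)

  entry-act : ∀ k f p → entry (k •ˣ f) p ≡ entry f (Action.act (copies r X) (inv k) p)
  entry-act k f (i , x) = cong (λ v → lookup v i) (lookup-•ˣ k f x)

  currying : Maps (Vec C r) X ≅ Res ι (Maps C Y)
  currying = record
    { to = uncurryᶿ ; from = curryᶿ ; to-cong = cong uncurryᶿ ; from-cong = cong curryᶿ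
    ; from-to = λ f → entry-ext _ f (λ p → begin
        entry (curryᶿ (uncurryᶿ f)) p   ≡⟨ entry-curry (uncurryᶿ f) p ⟩
        lookup (uncurryᶿ f) (θ.from p)  ≡⟨ lookup∘tabulate (λ y → entry f (θ.to y)) _ ⟩
        entry f (θ.to (θ.from p))       ≡⟨ cong (entry f) (θ.to-from p) ⟩
        entry f p                       ∎)
    ; to-from = λ g → vec-ext _ g (λ y → begin
        lookup (uncurryᶿ (curryᶿ g)) y   ≡⟨ lookup∘tabulate _ y ⟩
        entry (curryᶿ g) (θ.to y)        ≡⟨ entry-curry g (θ.to y) ⟩
        lookup g (θ.from (θ.to y))       ≡⟨ cong (lookup g) (θ.from-to y) ⟩
        lookup g y                       ∎)
    ; equivariant = λ k f → vec-ext _ _ (λ y → begin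
        lookup (uncurryᶿ (k •ˣ f)) y
          ≡⟨ lookup∘tabulate _ y ⟩
        entry (k •ˣ f) (θ.to y)
          ≡⟨ entry-act k f (θ.to y) ⟩
        entry f (Action.act (copies r X) (inv k) (θ.to y))
          ≡⟨ cong (entry f) (sym (θ.equivariant (inv k) y)) ⟩
        entry f (θ.to (Y.act (map (inv k)) y))
          ≡⟨ sym (lookup∘tabulate (λ y' → entry f (θ.to y')) _) ⟩
        lookup (uncurryᶿ f) (Y.act (map (inv k)) y)
          ≡⟨ cong (λ u → lookup (uncurryᶿ f) (Y.act u y)) (map-inv k) ⟩
        lookup (uncurryᶿ f) (Y.act (FinGroup.inv G' (map k)) y)
          ≡⟨ sym (lookup-•ʸ (map k) (uncurryᶿ f) y) ⟩
        lookup (map k •ʸ uncurryᶿ f) y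
          ∎) }

J-restriction : {G G' : FinGroup} (ι : SubgroupEmbedding G G') (X : FinGSet G) (r : ℕ)
  (Y : FinGSet G') → Res ι (toAction Y) ≅ copies r X →
  (C : Set) (_≟ᶜ_ : DecidableEquality C) (c : C) →
  J (Vec C r) (≡-dec _≟ᶜ_) (replicate r c) X ≅ Res ι (J C _≟ᶜ_ c Y)
J-restriction ι X r Y θ C _≟ᶜ_ c =
  ≅-trans lawful-X (resLawful ι _ (MapsLemmas.mapsLawful Y _))
    (≅-trans lawful-X (resLawful ι _ (MapsLemmas.mapsLawful Y C))
      (MapsLemmas.postcompose X (ValueCode.valueCode (Vec C r) (≡-dec _≟ᶜ_) (replicate r c)))
      (Currying.currying ι X r Y θ C))
    (Res-≅ ι (MapsLemmas.postcompose Y (↔-sym (ValueCode.valueCode C _≟ᶜ_ c))))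
  where
  lawful-X : Lawful (Maps (ValueCode.Value (Vec C r) (≡-dec _≟ᶜ_) (replicate r c)) X)
  lawful-X = MapsLemmas.mapsLawful X _

-- An equivariant map that preserves and reflects the equality of G-sets,
-- i.e. an isomorphism onto a union of orbits.
record EquivariantEmbedding {G : FinGroup} (A B : Action G) : Set where
  private
    module A = Action A
    module B = Action B
  field
    embed         : A.Carrier → B.Carrier
    embed-cong    : ∀ {x y} → x A.≈ y → embed x B.≈ embed y
    embed-reflect : ∀ {x y} → embed x B.≈ embed y → x A.≈ y
    equivariant   : ∀ g x → embed (A.act g x) B.≈ B.act g (embed x)

module EmbeddingProps {G : FinGroup} {A B : Action G} (LA : Lawful A) (LB : Lawful B)
  (φ : EquivariantEmbedding A B) where
  open EquivariantEmbedding φ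
  open Lawful LB
  private
    module A = ActionLemmas A LA
    module B = ActionLemmas B LB

  stab-embed : ∀ x → A.Stab x ⇔ᴾ B.Stab (embed x)
  stab-embed x h = (λ s → trans≈ (sym≈ (equivariant h x)) (embed-cong s)) ,
                   (λ s → embed-reflect (trans≈ (equivariant h x) s))

  stab-transfer : ∀ {x y} → Action._≈_ B (embed x) y → B.Stab y ⇔ᴾ A.Stab x
  stab-transfer {x} p = ⇔ᴾ-sym (⇔ᴾ-trans (stab-embed x) (B.stab-≈ p))

  so-embed : ∀ {x y} → A.SO x y → B.SO (embed x) (embed y)
  so-embed {x} (g , p) = g , trans≈ (sym≈ (equivariant g x)) (embed-cong p)

  so-reflect : ∀ {x y} → B.SO (embed x) (embed y) → A.SO x y
  so-reflect {x} (g , p) = g , embed-reflect (trans≈ (equivariant g x) p)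

≅⇒embedding : {G : FinGroup} {A B : Action G} → Lawful A → A ≅ B → EquivariantEmbedding A B
≅⇒embedding LA φ = record
  { embed = to ; embed-cong = to-cong ; equivariant = equivariant
  ; embed-reflect = λ p → trans≈ (sym≈ (from-to _)) (trans≈ (from-cong p) (from-to _)) }
  where
  open _≅_ φ
  open Lawful LA

Res-embedding : {G G' : FinGroup} (ι : SubgroupEmbedding G G') {A B : Action G'} →
  EquivariantEmbedding A B → EquivariantEmbedding (Res ι A) (Res ι B)
Res-embedding ι φ = record
  { embed = embed ; embed-cong = embed-cong ; embed-reflect = embed-reflect
  ; equivariant = λ g → equivariant (SubgroupEmbedding.map ι g) }
  where open EquivariantEmbedding φ

orbitLawful : {G : FinGroup} (A : Action G) → Lawful A → ∀ x → Lawful (Orbit A x)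
orbitLawful {G} A L x = record
  { refl≈ = refl≈ ; sym≈ = sym≈ ; trans≈ = trans≈
  ; act-cong = λ g {a} {b} p → trans≈ (act-· g a x) (trans≈ (act-cong g p) (sym≈ (act-· g b x)))
  ; act-e    = λ a → ≡⇒≈ (cong (λ u → act u x) (identityˡ a))
  ; act-·    = λ g h a → ≡⇒≈ (cong (λ u → act u x) (assoc g h a)) }
  where
  open FinGroup G
  open Action A
  open Lawful L
  open ActionLemmas A L using (≡⇒≈)

module OrbitStabiliser {G : FinGroup} (A : Action G) (LA : Lawful A) (H : Subgroup G) where
  open FinGroup G
  open Action A
  open Lawful LA
  open GroupLemmas G
  open ActionLemmas A LA
  private
    module Coset = ActionLemmas (Coset H) (cosetLawful H)
    module Orb x = ActionLemmas (Orbit A x) (orbitLawful A LA x)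
    H∋_ : El G → Set
    H∋ h = h ∈ Subgroup.members H

  coset-stab-e : H∋_ ⇔ᴾ Coset.Stab e
  coset-stab-e h =
    (λ p → subst H∋_ (sym inv-h·e·e) (Subgroup.closed-inv H p)) ,
    (λ p → subst H∋_ (inv-inv h) (Subgroup.closed-inv H (subst H∋_ inv-h·e·e p)))
    where
    inv-h·e·e : inv (h · e) · e ≡ inv h
    inv-h·e·e = trans (identityʳ _) (cong inv (identityʳ h))

  orbit-stab-e : ∀ x → Stab x ⇔ᴾ Orb.Stab x e
  orbit-stab-e x h =
    (λ s → trans≈ (≡⇒≈ (cong (λ u → act u x) (identityʳ h))) (trans≈ s (sym≈ (act-e x)))) ,
    (λ s → trans≈ (≡⇒≈ (cong (λ u → act u x) (sym (identityʳ h)))) (trans≈ s (act-e x)))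

  orbit≅coset⇒conjugate : ∀ x → Orbit A x ≅ Coset H → Conjugateᴾ (Stab x) H∋_
  orbit≅coset⇒conjugate x iso =
    conjugate-respˡ {S = Coset.Stab s} {T = H∋_} (⇔ᴾ-sym stab-x⇔stab-s)
      (conjugate-sym {S = H∋_} {T = Coset.Stab s} H~stab-s)
    where
    orbit-lawful : Lawful (Orbit A x)
    orbit-lawful = orbitLawful A LA x
    open EmbeddingProps orbit-lawful (cosetLawful H) (≅⇒embedding orbit-lawful iso)
    s : El G
    s = _≅_.to iso e
    stab-x⇔stab-s : Stab x ⇔ᴾ Coset.Stab s
    stab-x⇔stab-s = ⇔ᴾ-trans (orbit-stab-e x) (stab-embed e)
    H~stab-s : Conjugateᴾ H∋_ (Coset.Stab s)
    H~stab-s = conjugate-respʳ {S = H∋_} {T = Coset.Stab (s · e)}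
      (Coset.stab-≈ (Coset.≡⇒≈ (identityʳ s)))
      (conjugate-respˡ {S = Coset.Stab e} {T = Coset.Stab (s · e)}
        (⇔ᴾ-sym coset-stab-e) (Coset.stab-translate s e))

  conjugate⇒orbit≅coset : ∀ x → Conjugateᴾ (Stab x) H∋_ → Orbit A x ≅ Coset H
  conjugate⇒orbit≅coset x (g , f) = record
    { to          = λ a → a · inv g
    ; from        = λ b → b · g
    ; to-cong     = λ {a} {b} p →
        subst H∋_ (sym (trans (conj-translate (inv g) a b) (cong (λ u → conj u _) (inv-inv g))))
          (proj₁ (f (inv a · b)) (same-image⇒stab x a b p))
    ; from-cong   = λ {a} {b} p → stab⇒same-image x (a · g) (b · g)
        (proj₂ (f _) (subst H∋_ (sym (trans (cong (conj g) (conj-translate g a b)) (conj-inv g _))) p))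
    ; from-to     = λ a → ≡⇒≈ (cong (λ u → act u x) (cancel-inv-right a g))
    ; to-from     = λ b → Coset.≡⇒≈ (cancel-right b g)
    ; equivariant = λ u a → Coset.≡⇒≈ (assoc u a (inv g)) }

record Census {G : FinGroup} (A : Action G) (P : El G → Set) (n : ℕ) : Set where
  open GroupLemmas G using (Conjugateᴾ)
  field
    rep          : Fin n → Action.Carrier A
    rep-type     : ∀ i → Conjugateᴾ (Stabiliser A (rep i)) P
    rep-distinct : ∀ i j → SameOrbit A (rep i) (rep j) → i ≡ j
    rep-complete : ∀ y → Conjugateᴾ (Stabiliser A y) P → Σ[ i ∈ Fin n ] SameOrbit A (rep i) y

hasMu⇒census : {G : FinGroup} {A : Action G} → Lawful A → {H : Subgroup G} {n : ℕ} →
  HasMu A H n → Census A (_∈ Subgroup.members H) n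
hasMu⇒census {A = A} LA {H} (xs , orbit≅ , distinct , complete) = record
  { rep          = xs
  ; rep-type     = λ i → orbit≅coset⇒conjugate (xs i) (orbit≅ i)
  ; rep-distinct = distinct
  ; rep-complete = λ y conj → complete y (conjugate⇒orbit≅coset y conj) }
  where open OrbitStabiliser A LA H

census-transport : {G : FinGroup} {A B : Action G} → Lawful A → Lawful B → A ≅ B →
  {P : El G → Set} {n : ℕ} → Census A P n → Census B P n
census-transport {G} {A} {B} LA LB φ {P} μ = record
  { rep          = λ i → to (rep i)
  ; rep-type     = λ i → conjugate-respˡ {T = P} (stab-embed (rep i)) (rep-type i)
  ; rep-distinct = λ i j so → rep-distinct i j (so-reflect so)
  ; rep-complete = λ y conj →
      let (i , so) = rep-complete (from y)
                       (conjugate-respˡ {T = P} (stab-transfer (to-from y)) conj)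
      in i , ActionLemmas.so-≈ B LB (so-embed so) (to-from y) }
  where
  open Census μ
  open _≅_ φ
  open GroupLemmas G
  open EmbeddingProps LA LB (≅⇒embedding LA φ)

does⇒witness : {P : Set} (d : Dec P) → does d ≡ true → P
does⇒witness (yes p) _ = p

-- With decidable equality stabilisers are subgroups; hence each orbit has a
-- type among a system V of representatives of Φ(G), and only one.
module OrbitTypes {G : FinGroup} (A : Action G) (LA : Lawful A)
  (_≈?_ : ∀ x y → Dec (Action._≈_ A x y))
  {t : ℕ} (V : Fin t → Subgroup G) (reps : ConjugacyReps G V) where
  open FinGroup G
  open Action A
  open Lawful LA
  open GroupLemmas G
  open ActionLemmas A LA

  stab-mask : Carrier → Subset order
  stab-mask w = tabulate (λ g → does (act g w ≈? w))

  stab-mask-correct : ∀ w → (_∈ stab-mask w) ⇔ᴾ Stab w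
  stab-mask-correct w g =
    (λ p → does⇒witness (act g w ≈? w) (trans (sym (lookup∘tabulate _ g)) ([]=⇒lookup p))) ,
    (λ s → lookup⇒[]= g _ (trans (lookup∘tabulate _ g) (dec-true (act g w ≈? w) s)))

  stabiliser : Carrier → Subgroup G
  stabiliser w = record
    { members    = stab-mask w
    ; has-e      = ⇒mask (act-e w)
    ; closed-·   = λ {x} {y} p q →
        ⇒mask (trans≈ (act-· x y w) (trans≈ (act-cong x (mask⇒ q)) (mask⇒ p)))
    ; closed-inv = λ {x} p → ⇒mask (trans≈ (act-cong (inv x) (sym≈ (mask⇒ p))) (act-inv-cancel x w)) }
    where
    mask⇒ : ∀ {g} → g ∈ stab-mask w → Stab w g
    mask⇒ = proj₁ (stab-mask-correct w _)
    ⇒mask : ∀ {g} → Stab w g → g ∈ stab-mask w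
    ⇒mask = proj₂ (stab-mask-correct w _)

  orbit-type : ∀ x → Σ[ i ∈ Fin t ] Conjugateᴾ (Stab x) (_∈ Subgroup.members (V i))
  orbit-type x =
    let (i , conj) = proj₁ reps (stabiliser x)
    in i , conjugate-respˡ {T = _∈ Subgroup.members (V i)} (stab-mask-correct x) conj

  orbit-type-unique : ∀ {x x' i i'} →
    Conjugateᴾ (Stab x) (_∈ Subgroup.members (V i)) → Conjugateᴾ (Stab x') (_∈ Subgroup.members (V i')) →
    SO x x' → i ≡ i'
  orbit-type-unique {x} {x'} {i} {i'} c c' so = proj₂ reps i i'
    (conjugate-trans {T = Stab x} {U = Vi'} (conjugate-sym {S = Stab x} c)
      (conjugate-trans {T = Stab x'} {U = Vi'} (so⇒conjugate so) c'))
    where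
    Vi' : El G → Set
    Vi' = _∈ Subgroup.members (V i')

module OrbitEmbedding {G : FinGroup} (W : Action G) (LW : Lawful W) (V : Subgroup G)
  (y : Action.Carrier W)
  (y-type : GroupLemmas.Conjugateᴾ G (Stabiliser W y) (_∈ Subgroup.members V)) where
  open FinGroup G
  open Action W
  open Lawful LW
  open ActionLemmas W LW
  open _≅_ (OrbitStabiliser.conjugate⇒orbit≅coset W LW V y y-type)
  private module Coset = Lawful (cosetLawful V)

  embedding : EquivariantEmbedding (Coset V) W
  embedding = record
    { embed         = λ z → act (from z) y
    ; embed-cong    = from-cong
    ; embed-reflect = λ p → Coset.trans≈ (Coset.sym≈ (to-from _)) (Coset.trans≈ (to-cong p) (to-from _))
    ; equivariant   = λ g z → trans≈ (≡⇒≈ (cong (λ u → act u y) (assoc _ _ _))) (act-· _ _ _) }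

  open EquivariantEmbedding embedding using (embed)

  in-orbit : ∀ z → SO y (embed z)
  in-orbit z = from z , refl≈

  onto-orbit : ∀ {x} → SO y x → Σ[ z ∈ El G ] (embed z ≈ x)
  onto-orbit (u , p) = to u , trans≈ (from-to u) p

Σ-Fin-split : {t : ℕ} (P : Fin (suc t) → Set) →
              Σ (Fin (suc t)) P ↔ (P zero ⊎ Σ (Fin t) (λ i → P (suc i)))
Σ-Fin-split P = mk↔ₛ′
  (λ { (zero , p) → inj₁ p ; (suc i , p) → inj₂ (i , p) })
  (λ { (inj₁ p) → zero , p ; (inj₂ (i , p)) → suc i , p })
  (λ { (inj₁ p) → refl ; (inj₂ (i , p)) → refl })
  (λ { (zero , p) → refl ; (suc i , p) → refl })

Fin-sum : (t : ℕ) (d : Fin t → ℕ) → Fin (sum (tabulate d)) ↔ Σ (Fin t) (λ i → Fin (d i))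
Fin-sum zero d = mk↔ₛ′ (λ ()) (λ { (() , _) }) (λ { (() , _) }) (λ ())
Fin-sum (suc t) d =
  ↔-trans +↔⊎ (↔-trans (↔-refl ⊎-↔ Fin-sum t (λ i → d (suc i)))
                       (↔-sym (Σ-Fin-split (λ i → Fin (d i)))))

↔-Fin⇒≡ : {a b : ℕ} → Fin a ↔ Fin b → a ≡ b
↔-Fin⇒≡ φ =
  cantor-schröder-bernstein (Injection.injective (↔⇒↣ φ)) (Injection.injective (↔⇒↣ (↔-sym φ)))

count-triples : {t n : ℕ} (c m : Fin t → ℕ) →
  Σ (Fin t) (λ i → Fin (c i) × Fin (m i)) ↔ Fin n → n ≡ sum (tabulate (λ i → c i * m i))
count-triples {t} c m φ =
  ↔-Fin⇒≡ (↔-trans (↔-sym φ)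
    (↔-trans (congˡ (↔-sym *↔×)) (↔-sym (Fin-sum t (λ i → c i * m i)))))

-- Every G'-orbit of W of type V_i is a copy of G'/V_i, so the G-orbits of
-- type H of Res W correspond to triples (i , l , j): a type V_i, a G-orbit l
-- of type H of Res G'/V_i and a G'-orbit j of W of type V_i.
module RestrictionCount {G G' : FinGroup} (ι : SubgroupEmbedding G G')
  (W : Action G') (LW : Lawful W) (_≈?_ : ∀ x y → Dec (Action._≈_ W x y))
  (H : Subgroup G) {t : ℕ} (V : Fin t → Subgroup G') (reps : ConjugacyReps G' V)
  {n : ℕ} {c m : Fin t → ℕ}
  (μ-Res   : Census (Res ι W) (_∈ Subgroup.members H) n)
  (μ-coset : ∀ i → Census (Res ι (Coset (V i))) (_∈ Subgroup.members H) (c i))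
  (μ-W     : ∀ i → Census W (_∈ Subgroup.members (V i)) (m i)) where
  open Action W using (Carrier)
  open OrbitTypes W LW _≈?_ V reps using (orbit-type; orbit-type-unique)
  private
    H∋_ : El G → Set
    H∋ h = h ∈ Subgroup.members H
    R : Action G
    R = Res ι W
    LR : Lawful R
    LR = resLawful ι W LW
    module W = ActionLemmas W LW
    module R = ActionLemmas R LR
    module GL = GroupLemmas G
    module μ-Res = Census μ-Res
    module μ-coset i = Census (μ-coset i)
    module μ-W i = Census (μ-W i)
    module Orbit' i j = OrbitEmbedding W LW (V i) (μ-W.rep i j) (μ-W.rep-type i j)

  Triple : Set
  Triple = Σ (Fin t) (λ i → Fin (c i) × Fin (m i))

  embedᴳ : ∀ i → Fin (m i) → EquivariantEmbedding (Res ι (Coset (V i))) R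
  embedᴳ i j = Res-embedding ι (Orbit'.embedding i j)

  private
    module Embedᴳ i j =
      EmbeddingProps (resLawful ι (Coset (V i)) (cosetLawful (V i))) LR (embedᴳ i j)
    embed : ∀ i → Fin (m i) → El G' → Carrier
    embed i j = EquivariantEmbedding.embed (embedᴳ i j)

  point : Triple → Carrier
  point (i , l , j) = embed i j (μ-coset.rep i l)

  point-type : ∀ p → GL.Conjugateᴾ (R.Stab (point p)) H∋_
  point-type (i , l , j) = GL.conjugate-respˡ {T = H∋_} (Embedᴳ.stab-embed i j _) (μ-coset.rep-type i l)

  G-orbit⇒G'-orbit : ∀ {x y} → R.SO x y → W.SO x y
  G-orbit⇒G'-orbit (g , p) = SubgroupEmbedding.map ι g , p

  orbit-link : ∀ {i j i' j' z z'} → R.SO (embed i j z) (embed i' j' z') →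
               W.SO (μ-W.rep i j) (μ-W.rep i' j')
  orbit-link {i} {j} {i'} {j'} so =
    W.so-trans (Orbit'.in-orbit i j _)
      (W.so-trans (G-orbit⇒G'-orbit so) (W.so-sym (Orbit'.in-orbit i' j' _)))

  -- the orbit type fixes i, the G'-orbit fixes j, the G-orbit in G'/V_i fixes l
  point-distinct : ∀ p q → R.SO (point p) (point q) → p ≡ q
  point-distinct (i , l , j) (i' , l' , j') so
    with orbit-type-unique (μ-W.rep-type i j) (μ-W.rep-type i' j') (orbit-link so)
  ... | refl with μ-W.rep-distinct i j j' (orbit-link so)
  ... | refl with μ-coset.rep-distinct i l l' (Embedᴳ.so-reflect i j so)
  ... | refl = refl

  locate : ∀ x → GL.Conjugateᴾ (R.Stab x) H∋_ → Σ[ p ∈ Triple ] R.SO (point p) x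
  locate x x-type =
    let (i , x-type') = orbit-type x
        (j , y~x)     = μ-W.rep-complete i x x-type'
        (z , z↦x)     = Orbit'.onto-orbit i j y~x
        (l , rep~z)   = μ-coset.rep-complete i z
                          (GL.conjugate-respˡ {T = H∋_} (Embedᴳ.stab-transfer i j z↦x) x-type)
    in (i , l , j) , R.so-≈ (Embedᴳ.so-embed i j rep~z) z↦x

  classify : Triple → Fin n
  classify p = proj₁ (μ-Res.rep-complete (point p) (point-type p))

  triples↔orbits : Triple ↔ Fin n
  triples↔orbits = mk↔ₛ′ classify unclassify
    (λ a → μ-Res.rep-distinct _ a (R.so-trans (classify-spec _) (proj₂ (locate-rep a))))
    (λ p → point-distinct _ p (R.so-trans (proj₂ (locate-rep (classify p))) (classify-spec p)))
    where
    classify-spec : ∀ p → R.SO (μ-Res.rep (classify p)) (point p)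
    classify-spec p = proj₂ (μ-Res.rep-complete (point p) (point-type p))
    locate-rep : ∀ a → Σ[ p ∈ Triple ] R.SO (point p) (μ-Res.rep a)
    locate-rep a = locate (μ-Res.rep a) (μ-Res.rep-type a)
    unclassify : Fin n → Triple
    unclassify a = proj₁ (locate-rep a)

  μ-Res-count : n ≡ sum (tabulate (λ i → c i * m i))
  μ-Res-count = count-triples c m triples↔orbits

theorem3p21 :
    (G G' : FinGroup) (ι : SubgroupEmbedding G G') (X : FinGSet G)
    (r : ℕ) → 1 ≤ r → (k : ℕ) → 2 ≤ k → (a : Fin k) → (Y : FinGSet G') →
    Res ι (toAction Y) ≅ copies r X →
    (J (Vec (Fin k) r) (≡-dec _≟_) (replicate r a) X ≅ Res ι (J (Fin k) _≟_ a Y))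
    × ((H : Subgroup G) (t : ℕ) (V : Fin t → Subgroup G') → ConjugacyReps G' V →
       (n : ℕ) (c m : Fin t → ℕ) →
       HasMu (J (Vec (Fin k) r) (≡-dec _≟_) (replicate r a) X) H n →
       (∀ i → HasMu (Res ι (Coset (V i))) H (c i)) →
       (∀ i → HasMu (J (Fin k) _≟_ a Y) (V i) (m i)) →
       n ≡ sum (tabulate (λ i → c i * m i)))
theorem3p21 G G' ι X r _ k _ a Y θ = ψ , μ-count
  where
  JX : Action G
  JX = J (Vec (Fin k) r) (≡-dec _≟_) (replicate r a) X
  JY : Action G'
  JY = J (Fin k) _≟_ a Y

  ψ : JX ≅ Res ι JY
  ψ = J-restriction ι X r Y θ (Fin k) _≟_ a

  lawful-JX : Lawful JX
  lawful-JX = MapsLemmas.mapsLawful X _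
  lawful-JY : Lawful JY
  lawful-JY = MapsLemmas.mapsLawful Y _

  μ-count : (H : Subgroup G) (t : ℕ) (V : Fin t → Subgroup G') → ConjugacyReps G' V →
    (n : ℕ) (c m : Fin t → ℕ) → HasMu JX H n → (∀ i → HasMu (Res ι (Coset (V i))) H (c i)) →
    (∀ i → HasMu JY (V i) (m i)) → n ≡ sum (tabulate (λ i → c i * m i))
  μ-count H t V reps n c m μ-JX μ-coset μ-JY =
    RestrictionCount.μ-Res-count ι JY lawful-JY (≡-dec (ValueCode._≟ⱽ_ (Fin k) _≟_ a)) H V reps
      (census-transport lawful-JX (resLawful ι JY lawful-JY) ψ (hasMu⇒census lawful-JX {H} μ-JX))
      (λ i → hasMu⇒census (resLawful ι (Coset (V i)) (cosetLawful (V i))) {H} (μ-coset i))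
      (λ i → hasMu⇒census lawful-JY {V i} (μ-JY i))
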